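{- Let $V$ be a finite vector space over $\mathbb{F}_3$ and let $A\subseteq V$ be primitive via clause (b) with data $(H,U,W,X)$, i.e. $H\subseteq V$ is a hyperplane with $0\notin H$, $U\subsetneq H$ a proper affine subspace, $W$ an $(H,U)$-half, $X$ a primitive subset of $C(U)$, and (i) $A=W\cup X$, (ii) $X\cap[U]=\emptyset$, (iii) $\dim(H/U)\ge 2$ or $X\ne -U$, (iv) $\mathrm{aff}(X\cap(-U))=-U$. Then $\mathrm{Sym}(A)=\mathrm{Sym}(X)\subseteq [U]$.
   Context: $\mathrm{Sym}(Y)=\{x\in V: Y+x=Y\}$. For an affine subspace $U$ of $V$, $[U]=U-U$, $\dim U=\dim[U]$; for $U\subseteq H$, $\dim(H/U)=\dim H-\dim U$; $C(U)$ is the linear span of $U$; a hyperplane is an affine subspace of codimension $1$; $\mathrm{aff}$ denotes affine hull. A set $W\subseteq H$ is an $(H,U)$-half if $W+[U]=W$ and $H$ is the disjoint union of $U$, $W$, $(-U)+(-W)$. Primitive sets (recursively on dimension): $A\subseteq V$ is primitive if either (a) $A$ is a hyperplane not containing $0$, or (b) there exist $H,U,W,X$ as in the claim (with $X$ primitive in $C(U)$) satisfying (i)–(iv). -}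

module Defs where

open import Data.Nat using (ℕ; zero; suc; _+_; _≤_)
open import Data.Unit using (⊤)
open import Data.Vec using (Vec; []; _∷_; zipWith; map; replicate)
open import Data.Vec.Relation.Unary.All using (All)
open import Data.Product using (Σ; _×_; _,_)
open import Data.Sum using (_⊎_)
open import Relation.Binary.PropositionalEquality using (_≡_)
open import Relation.Nullary using (¬_)

data F3 : Set where
  f0 f1 f2 : F3

-F_ : F3 → F3
-F f0 = f0
-F f1 = f2
-F f2 = f1

_+F_ : F3 → F3 → F3
f0 +F b  = b
f1 +F f0 = f1
f1 +F f1 = f2
f1 +F f2 = f0
f2 +F f0 = f2
f2 +F f1 = f0
f2 +F f2 = f1

_*F_ : F3 → F3 → F3
f0 *F b = f0
f1 *F b = b
f2 *F b = -F b

V : ℕ → Set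
V n = Vec F3 n

0V : ∀ {n} → V n
0V {n} = replicate n f0

_+V_ : ∀ {n} → V n → V n → V n
_+V_ = zipWith _+F_

-V_ : ∀ {n} → V n → V n
-V_ = map -F_

_-V_ : ∀ {n} → V n → V n → V n
x -V y = x +V (-V y)

_·_ : ∀ {n} → F3 → V n → V n
c · v = map (c *F_) v

lincomb : ∀ {n k} → Vec F3 k → Vec (V n) k → V n
lincomb [] [] = 0V
lincomb (c ∷ cs) (v ∷ vs) = (c · v) +V lincomb cs vs

sumF : ∀ {k} → Vec F3 k → F3
sumF [] = f0
sumF (c ∷ cs) = c +F sumF cs

Subset : ℕ → Set₁
Subset n = V n → Set

Full : ∀ n → Subset n
Full n x = ⊤

_⊆_ : ∀ {n} → Subset n → Subset n → Set
A ⊆ B = ∀ x → A x → B x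

_≐_ : ∀ {n} → Subset n → Subset n → Set
A ≐ B = (A ⊆ B) × (B ⊆ A)

_∪_ : ∀ {n} → Subset n → Subset n → Subset n
(A ∪ B) x = A x ⊎ B x

_∩_ : ∀ {n} → Subset n → Subset n → Subset n
(A ∩ B) x = A x × B x

Neg : ∀ {n} → Subset n → Subset n
Neg U x = Σ _ λ u → U u × (x ≡ -V u)

SumSet : ∀ {n} → Subset n → Subset n → Subset n
SumSet A B x = Σ _ λ a → Σ _ λ b → A a × B b × (x ≡ a +V b)

Translate : ∀ {n} → Subset n → V n → Subset n
Translate Y v z = Σ _ λ y → Y y × (z ≡ y +V v)

-- [U] = U - U
Diff : ∀ {n} → Subset n → Subset n
Diff U x = Σ _ λ a → Σ _ λ b → U a × U b × (x ≡ a -V b)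

Sym : ∀ {n} → Subset n → Subset n
Sym Y x = Translate Y x ≐ Y

LinSub : ∀ {n} → Subset n → Set
LinSub L = L 0V
         × (∀ x y → L x → L y → L (x +V y))
         × (∀ c x → L x → L (c · x))

Independent : ∀ {n k} → Vec (V n) k → Set
Independent {k = k} bs = ∀ cs → lincomb cs bs ≡ 0V → cs ≡ replicate k f0

HasDim : ∀ {n} → Subset n → ℕ → Set
HasDim {n} L d = LinSub L × Σ (Vec (V n) d) λ bs →
  All L bs × Independent bs × (∀ x → L x → Σ (Vec F3 d) λ cs → x ≡ lincomb cs bs)

-- C(U): linear span
Span : ∀ {n} → Subset n → Subset n
Span {n} U x = Σ ℕ λ k → Σ (Vec (V n) k) λ vs → All U vs ×
  Σ (Vec F3 k) λ cs → x ≡ lincomb cs vs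

AffHull : ∀ {n} → Subset n → Subset n
AffHull {n} S x = Σ ℕ λ k → Σ (Vec (V n) k) λ vs → All S vs ×
  Σ (Vec F3 k) λ cs → (sumF cs ≡ f1) × (x ≡ lincomb cs vs)

Affine : ∀ {n} → Subset n → Set₁
Affine {n} U = Σ (V n) λ p → Σ (Subset n) λ L → LinSub L ×
  (∀ x → (U x → Σ _ λ l → L l × (x ≡ p +V l)) × ((Σ _ λ l → L l × (x ≡ p +V l)) → U x))

-- H is a hyperplane of the linear subspace E (affine subspace of E of codimension 1);
-- dim H := dim [H]
Hyperplane : ∀ {n} → Subset n → Subset n → Set₁
Hyperplane E H = Affine H × (H ⊆ E) × Σ ℕ λ d → HasDim E (suc d) × HasDim (Diff H) d

ProperAffSub : ∀ {n} → Subset n → Subset n → Set₁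
ProperAffSub U H = Affine U × (U ⊆ H) × Σ _ λ h → H h × ¬ U h

Half : ∀ {n} → Subset n → Subset n → Subset n → Set
Half H U W = (W ⊆ H)
  × (SumSet W (Diff U) ≐ W)
  × (∀ x → (H x → U x ⊎ W x ⊎ Z x) × (U x ⊎ W x ⊎ Z x → H x))
  × (∀ x → ¬ (U x × W x)) × (∀ x → ¬ (U x × Z x)) × (∀ x → ¬ (W x × Z x))
  where Z = SumSet (Neg U) (Neg W)

CondIII : ∀ {n} → Subset n → Subset n → Subset n → Set
CondIII H U X =
  (Σ ℕ λ dH → Σ ℕ λ dU → HasDim (Diff H) dH × HasDim (Diff U) dU × (2 + dU ≤ dH))
  ⊎ ¬ (X ≐ Neg U)

-- Primitive sets: Primitive E A means A is primitive in the linear subspace E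

data Primitive {n} : Subset n → Subset n → Set₁ where
  clauseA : ∀ {E A} → Hyperplane E A → ¬ A 0V → Primitive E A
  clauseB : ∀ {E A} (H U W X : Subset n)
    → Hyperplane E H → ¬ H 0V
    → ProperAffSub U H
    → Half H U W
    → Primitive (Span U) X
    → A ≐ (W ∪ X)
    → (∀ x → X x → ¬ Diff U x)
    → CondIII H U X
    → AffHull (X ∩ Neg U) ≐ Neg U
    → Primitive E A

module Submission where

-- Write U = p + L and H = q + M.  Since 0 ∉ H ⊇ U, each vector of C(U) lies in a unique coset
-- t·p + L (its level over U), and its level over H is the same t.  X avoids level 0 by (ii),
-- so a period s of X has level 0: otherwise x, x + s, x + 2s would meet all three levels.
-- Hence Sym X ⊆ L = [U], and such periods also preserve the half W, so Sym X ⊆ Sym A.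
-- Conversely a period s of A has level 0 over H by the same argument.  Starting from
-- x₀ ∈ X ∩ (−U), given by (iv), x₀ + s stays at level 2 over H, so it lies in X rather than in
-- W ⊆ H; thus s ∈ C(U), and since A ∩ C(U) = X, s is a period of X.

open import Defs
open import Data.Nat using (ℕ)
open import Data.Product using (Σ; _×_; _,_; proj₁; proj₂)
open import Data.Sum using (_⊎_; inj₁; inj₂)
open import Data.Empty using (⊥-elim)
open import Data.Vec using (Vec; []; _∷_; replicate)
open import Data.Vec.Relation.Unary.All using (All; []; _∷_)
open import Data.Vec.Properties
  using (zipWith-assoc; zipWith-comm; zipWith-identityˡ; zipWith-identityʳ; zipWith-inverseˡ; zipWith-inverseʳ;
         map-id; map-const; map-replicate; map-∘; map-cong)
open import Algebra.Bundles using (AbelianGroup)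
open import Algebra.Structures using (IsAbelianGroup)
open import Algebra.Definitions
  using (Associative; Commutative; RightIdentity; LeftInverse; RightInverse;
         _DistributesOverˡ_; _DistributesOverʳ_; RightZero)
import Algebra.Properties.AbelianGroup as AbelianGroupProperties
import Algebra.Properties.CommutativeSemigroup as CommutativeSemigroupProperties
open import Level using (0ℓ)
open import Relation.Binary.Definitions using (DecidableEquality)
open import Relation.Unary using (Decidable)
open import Relation.Nullary using (¬_; Dec; yes; no)
open import Relation.Nullary.Decidable using (from-yes; map′; _×-dec_; _⊎-dec_; _→-dec_)
open import Relation.Binary.PropositionalEquality
  using (_≡_; refl; sym; trans; cong; cong₂; subst; subst₂; isEquivalence; module ≡-Reasoning)

variable
  n : ℕ
  t u : F3
  p q s x y y₀ : V n
  L M U W X Y Z : Subset n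

_≟F_ : DecidableEquality F3
f0 ≟F f0 = yes refl
f1 ≟F f1 = yes refl
f2 ≟F f2 = yes refl
f0 ≟F f1 = no λ ()
f0 ≟F f2 = no λ ()
f1 ≟F f0 = no λ ()
f1 ≟F f2 = no λ ()
f2 ≟F f0 = no λ ()
f2 ≟F f1 = no λ ()

∀F3? : {P : F3 → Set} → Decidable P → Dec (∀ a → P a)
∀F3? P? = map′ (λ (p₀ , p₁ , p₂) → λ { f0 → p₀ ; f1 → p₁ ; f2 → p₂ })
               (λ h → h f0 , h f1 , h f2)
               (P? f0 ×-dec P? f1 ×-dec P? f2)

+F-assoc : Associative _≡_ _+F_
+F-assoc = from-yes (∀F3? λ a → ∀F3? λ b → ∀F3? λ c → ((a +F b) +F c) ≟F (a +F (b +F c)))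

+F-comm : Commutative _≡_ _+F_
+F-comm = from-yes (∀F3? λ a → ∀F3? λ b → (a +F b) ≟F (b +F a))

+F-identityʳ : RightIdentity _≡_ f0 _+F_
+F-identityʳ = from-yes (∀F3? λ a → (a +F f0) ≟F a)

+F-inverseˡ : LeftInverse _≡_ f0 -F_ _+F_
+F-inverseˡ = from-yes (∀F3? λ a → ((-F a) +F a) ≟F f0)

+F-inverseʳ : RightInverse _≡_ f0 -F_ _+F_
+F-inverseʳ = from-yes (∀F3? λ a → (a +F (-F a)) ≟F f0)

*F-assoc : Associative _≡_ _*F_
*F-assoc = from-yes (∀F3? λ a → ∀F3? λ b → ∀F3? λ c → ((a *F b) *F c) ≟F (a *F (b *F c)))

*F-identityʳ : RightIdentity _≡_ f1 _*F_
*F-identityʳ = from-yes (∀F3? λ a → (a *F f1) ≟F a)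

*F-zeroʳ : RightZero _≡_ f0 _*F_
*F-zeroʳ = from-yes (∀F3? λ a → (a *F f0) ≟F f0)

*F-distribˡ-+F : _DistributesOverˡ_ _≡_ _*F_ _+F_
*F-distribˡ-+F = from-yes (∀F3? λ a → ∀F3? λ b → ∀F3? λ c → (a *F (b +F c)) ≟F ((a *F b) +F (a *F c)))

*F-distribʳ-+F : _DistributesOverʳ_ _≡_ _*F_ _+F_
*F-distribʳ-+F = from-yes (∀F3? λ a → ∀F3? λ b → ∀F3? λ c → ((b +F c) *F a) ≟F ((b *F a) +F (c *F a)))

x-y≡f0⇒x≡y : ∀ a b → (a +F (-F b)) ≡ f0 → a ≡ b
x-y≡f0⇒x≡y = from-yes (∀F3? λ a → ∀F3? λ b → (a +F (-F b)) ≟F f0 →-dec a ≟F b)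

≡f0⊎square≡f1 : ∀ a → a ≡ f0 ⊎ (a *F a) ≡ f1
≡f0⊎square≡f1 = from-yes (∀F3? λ a → a ≟F f0 ⊎-dec (a *F a) ≟F f1)

progression-hits-f0 : ∀ a c → c ≡ f0 ⊎ a ≡ f0 ⊎ (a +F c) ≡ f0 ⊎ ((a +F c) +F c) ≡ f0
progression-hits-f0 = from-yes (∀F3? λ a → ∀F3? λ c →
  c ≟F f0 ⊎-dec a ≟F f0 ⊎-dec (a +F c) ≟F f0 ⊎-dec ((a +F c) +F c) ≟F f0)

+V-isAbelianGroup : IsAbelianGroup _≡_ (_+V_ {n}) 0V (-V_)
+V-isAbelianGroup = record
  { isGroup = record
    { isMonoid = record
      { isSemigroup = record
        { isMagma = record { isEquivalence = isEquivalence ; ∙-cong = cong₂ _+V_ }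
        ; assoc = zipWith-assoc +F-assoc
        }
      ; identity = zipWith-identityˡ (λ _ → refl) , zipWith-identityʳ +F-identityʳ
      }
    ; inverse = zipWith-inverseˡ +F-inverseˡ , zipWith-inverseʳ +F-inverseʳ
    ; ⁻¹-cong = cong (-V_)
    }
  ; comm = zipWith-comm +F-comm
  }

+V-abelianGroup : ℕ → AbelianGroup 0ℓ 0ℓ
+V-abelianGroup n = record { isAbelianGroup = +V-isAbelianGroup {n} }

module +V {n : ℕ} where
  open AbelianGroup (+V-abelianGroup n) public using (identityˡ; identityʳ; inverseʳ)
  open AbelianGroupProperties (+V-abelianGroup n) public
    using (xyx⁻¹≈y; ⁻¹-anti-homo‿-; //-rightDividesˡ; //-rightDividesʳ)
  open CommutativeSemigroupProperties (AbelianGroup.commutativeSemigroup (+V-abelianGroup n)) public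
    using (interchange)

·-distribˡ : ∀ c (x y : V n) → c · (x +V y) ≡ (c · x) +V (c · y)
·-distribˡ c []       []       = refl
·-distribˡ c (a ∷ x) (b ∷ y) = cong₂ _∷_ (*F-distribˡ-+F c a b) (·-distribˡ c x y)

·-distribʳ : ∀ c d (x : V n) → (c +F d) · x ≡ (c · x) +V (d · x)
·-distribʳ c d []      = refl
·-distribʳ c d (a ∷ x) = cong₂ _∷_ (*F-distribʳ-+F a c d) (·-distribʳ c d x)

·-assoc : ∀ c d (x : V n) → (c *F d) · x ≡ c · (d · x)
·-assoc c d x = trans (map-cong (*F-assoc c d) x) (map-∘ (c *F_) (d *F_) x)

·-identityˡ : ∀ (x : V n) → f1 · x ≡ x
·-identityˡ = map-id

·-zeroˡ : ∀ (x : V n) → f0 · x ≡ 0V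
·-zeroˡ x = map-const x f0

·-zeroʳ : ∀ c → c · 0V {n} ≡ 0V
·-zeroʳ {n} c = trans (map-replicate (c *F_) f0 n) (cong (replicate n) (*F-zeroʳ c))

-- AtLevel p L t y says y ∈ t·p + L.  For U = p + L with 0 ∉ U, level 1 is U, level 2 is −U,
-- level 0 is [U] = L, and the graded vectors form C(U).
record AtLevel (p : V n) (L : Subset n) (t : F3) (y : V n) : Set where
  constructor level
  field
    offset     : V n
    offset∈L   : L offset
    decomposes : y ≡ (t · p) +V offset

Graded : V n → Subset n → Subset n
Graded p L y = Σ F3 λ t → AtLevel p L t y

Stable : Subset n → V n → Set
Stable Y s = ∀ y → Y y → Y (y +V s)

module Frame (p : V n) {L : Subset n} (linL : LinSub L) where

  level-0V : AtLevel p L f0 0V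
  level-0V = level 0V (proj₁ linL) (sym (trans (+V.identityʳ (f0 · p)) (·-zeroˡ p)))

  base-level₁ : AtLevel p L f1 p
  base-level₁ = level 0V (proj₁ linL) (sym (trans (+V.identityʳ (f1 · p)) (·-identityˡ p)))

  translate-level₁ : ∀ {l} → L l → AtLevel p L f1 (p +V l)
  translate-level₁ {l} l∈L = level l l∈L (cong (_+V l) (sym (·-identityˡ p)))

  level-+ : AtLevel p L t x → AtLevel p L u y → AtLevel p L (t +F u) (x +V y)
  level-+ {t = t} {u = u} (level l l∈L refl) (level m m∈L refl) =
    level (l +V m) (proj₁ (proj₂ linL) l m l∈L m∈L)
      (trans (+V.interchange (t · p) l (u · p) m) (cong (_+V (l +V m)) (sym (·-distribʳ t u p))))

  level-· : ∀ c → AtLevel p L t x → AtLevel p L (c *F t) (c · x)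
  level-· {t = t} c (level l l∈L refl) =
    level (c · l) (proj₂ (proj₂ linL) c l l∈L)
      (trans (·-distribˡ c (t · p) l) (cong (_+V (c · l)) (sym (·-assoc c t p))))

  level-− : AtLevel p L t x → AtLevel p L u y → AtLevel p L (u +F (-F t)) (y -V x)
  level-− x∈ y∈ = level-+ y∈ (level-· f2 x∈)

  Graded-linear : LinSub (Graded p L)
  Graded-linear = (f0 , level-0V)
                , (λ { _ _ (t , x∈) (u , y∈) → t +F u , level-+ x∈ y∈ })
                , (λ { c _ (t , x∈) → c *F t , level-· c x∈ })

  -- A nonzero level of 0 can be scaled to level 1, since every nonzero d ∈ F₃ has d² = 1.
  level-unique : ¬ AtLevel p L f1 0V → AtLevel p L t y → AtLevel p L u y → t ≡ u
  level-unique {t = t} {y = y} {u = u} 0∉level₁ y∈t y∈u with ≡f0⊎square≡f1 (u +F (-F t))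
  ... | inj₁ d≡0 = sym (x-y≡f0⇒x≡y u t d≡0)
  ... | inj₂ d²≡1 = ⊥-elim (0∉level₁ (subst₂ (AtLevel p L) d²≡1 (·-zeroʳ d) (level-· d 0∈d)))
    where
    d = u +F (-F t)
    0∈d : AtLevel p L d 0V
    0∈d = subst (AtLevel p L d) (+V.inverseʳ y) (level-− y∈t y∈u)

  level-cast : t ≡ u → AtLevel p L t y → AtLevel p L u y
  level-cast {y = y} = subst (λ c → AtLevel p L c y)

  Graded-translation : Graded p L y → Graded p L (y +V s) → Graded p L s
  Graded-translation {y = y} {s = s} (a , y∈a) (b , y+s∈b) =
    b +F (-F a) , subst (AtLevel p L _) (+V.xyx⁻¹≈y y s) (level-− y∈a y+s∈b)

  -- The orbit y₀, y₀ + s, y₀ + 2s runs through all three levels unless s has level 0.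
  period-at-level₀ : (∀ y → Y y → Graded p L y) → (∀ y → Y y → ¬ AtLevel p L f0 y)
                   → Stable Y s → Y y₀ → AtLevel p L f0 s
  period-at-level₀ {Y = Y} {s = s} {y₀ = y₀} graded avoids stable y₀∈Y =
    go (graded y₀ y₀∈Y) (Graded-translation (graded y₀ y₀∈Y) (graded _ y₁∈Y))
    where
    y₁∈Y = stable y₀ y₀∈Y
    y₂∈Y = stable (y₀ +V s) y₁∈Y
    go : Graded p L y₀ → Graded p L s → AtLevel p L f0 s
    go (a , y₀∈a) (c , s∈c) with progression-hits-f0 a c
    ... | inj₁ c≡0 = level-cast c≡0 s∈c
    ... | inj₂ (inj₁ a≡0) = ⊥-elim (avoids _ y₀∈Y (level-cast a≡0 y₀∈a))
    ... | inj₂ (inj₂ (inj₁ a+c≡0)) =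
      ⊥-elim (avoids _ y₁∈Y (level-cast a+c≡0 (level-+ y₀∈a s∈c)))
    ... | inj₂ (inj₂ (inj₂ a+2c≡0)) =
      ⊥-elim (avoids _ y₂∈Y (level-cast a+2c≡0 (level-+ (level-+ y₀∈a s∈c) s∈c)))

level-transfer : LinSub L → LinSub M
               → (∀ x → AtLevel p L f1 x → AtLevel q M f1 x)
               → AtLevel p L t y → AtLevel q M t y
level-transfer {L = L} {M = M} {p = p} {q = q} {t = t} linL linM level₁⊆level₁ (level l l∈L refl) =
  HF.level-cast (trans (+F-identityʳ (t *F f1)) (*F-identityʳ t)) (HF.level-+ (HF.level-· t p∈₁) l∈₀)
  where
  module LF = Frame p linL
  module HF = Frame q linM
  p∈₁ : AtLevel q M f1 p
  p∈₁ = level₁⊆level₁ p LF.base-level₁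
  l∈₀ : AtLevel q M f0 l
  l∈₀ = subst (AtLevel q M f0) (+V.xyx⁻¹≈y p l)
              (HF.level-− p∈₁ (level₁⊆level₁ (p +V l) (LF.translate-level₁ l∈L)))

Span-least : LinSub Y → U ⊆ Y → Span U ⊆ Y
Span-least {Y = Y} {U = U} linY U⊆Y x (_ , vs , vs∈U , cs , refl) = lincomb∈ cs vs vs∈U
  where
  lincomb∈ : ∀ {k} (cs : Vec F3 k) (vs : Vec (V _) k) → All U vs → Y (lincomb cs vs)
  lincomb∈ []       []       []           = proj₁ linY
  lincomb∈ (c ∷ cs) (v ∷ vs) (v∈U ∷ vs∈U) =
    proj₁ (proj₂ linY) _ _ (proj₂ (proj₂ linY) c v (U⊆Y v v∈U)) (lincomb∈ cs vs vs∈U)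

Primitive⇒⊆ : {E A : Subset n} → Primitive E A → LinSub Y → E ⊆ Y → A ⊆ Y
Primitive⇒⊆ (clauseA (_ , H⊆E , _) _) linY E⊆Y x x∈A = E⊆Y x (H⊆E x x∈A)
Primitive⇒⊆ (clauseB _ _ _ _ (_ , H⊆E , _) _ (_ , U⊆H , _) (W⊆H , _) X-prim A≐W∪X _ _ _) linY E⊆Y x x∈A
  with proj₁ A≐W∪X x x∈A
... | inj₁ x∈W = E⊆Y x (H⊆E x (W⊆H x x∈W))
... | inj₂ x∈X = Primitive⇒⊆ X-prim linY (Span-least linY λ u u∈U → E⊆Y u (H⊆E u (U⊆H u u∈U))) x x∈X

AffHull-inhabited : AffHull Y x → Σ _ Y
AffHull-inhabited (_ , [] , [] , [] , () , _)
AffHull-inhabited (_ , v ∷ _ , v∈Y ∷ _ , _) = v , v∈Y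

IsCoset : Subset n → V n → Subset n → Set
IsCoset U p L = ∀ x → (U x → Σ _ λ l → L l × (x ≡ p +V l)) × ((Σ _ λ l → L l × (x ≡ p +V l)) → U x)

module Coset {U : Subset n} {p : V n} {L : Subset n} (linL : LinSub L) (U≐p+L : IsCoset U p L) where
  open Frame p linL public

  ∈⇒level₁ : U x → AtLevel p L f1 x
  ∈⇒level₁ {x} x∈U with proj₁ (U≐p+L x) x∈U
  ... | l , l∈L , refl = translate-level₁ l∈L

  level₁⇒∈ : AtLevel p L f1 x → U x
  level₁⇒∈ {x} (level l l∈L x≡) = proj₂ (U≐p+L x) (l , l∈L , trans x≡ (cong (_+V l) (·-identityˡ p)))

  base∈ : U p
  base∈ = level₁⇒∈ base-level₁

  Neg⇒level₂ : Neg U x → AtLevel p L f2 x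
  Neg⇒level₂ (u , u∈U , refl) = level-· f2 (∈⇒level₁ u∈U)

  level₀⇒Diff : AtLevel p L f0 s → Diff U s
  level₀⇒Diff (level l l∈L refl) =
    p +V l , p , proj₂ (U≐p+L _) (l , l∈L , refl) , base∈ , (begin
      (f0 · p) +V l   ≡⟨ cong (_+V l) (·-zeroˡ p) ⟩
      0V +V l         ≡⟨ +V.identityˡ l ⟩
      l               ≡⟨ +V.xyx⁻¹≈y p l ⟨
      (p +V l) -V p   ∎)
    where open ≡-Reasoning

  Span⊆Graded : Span U ⊆ Graded p L
  Span⊆Graded = Span-least Graded-linear λ x x∈U → f1 , ∈⇒level₁ x∈U

Sym⇒Stable : Sym Y s → Stable Y s
Sym⇒Stable (Y+s⊆Y , _) y y∈Y = Y+s⊆Y _ (y , y∈Y , refl)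

Sym⇒Stable⁻ : Sym Y s → Stable Y (-V s)
Sym⇒Stable⁻ {Y = Y} {s = s} (_ , Y⊆Y+s) y y∈Y with Y⊆Y+s y y∈Y
... | z , z∈Y , refl = subst Y (sym (+V.//-rightDividesʳ s z)) z∈Y

Stable⇒Sym : Stable Y s → Stable Y (-V s) → Sym Y s
Stable⇒Sym {s = s} Y+s⊆Y Y-s⊆Y =
  (λ { _ (y , y∈Y , refl) → Y+s⊆Y y y∈Y }) ,
  (λ z z∈Y → z -V s , Y-s⊆Y z z∈Y , sym (+V.//-rightDividesˡ s z))

Stable-resp-≐ : Y ≐ Z → Stable Z s → Stable Y s
Stable-resp-≐ (Y⊆Z , Z⊆Y) Z-stable y y∈Y = Z⊆Y _ (Z-stable y (Y⊆Z y y∈Y))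

Stable-∪ : Stable Y s → Stable Z s → Stable (Y ∪ Z) s
Stable-∪ Y-stable Z-stable y (inj₁ y∈Y) = inj₁ (Y-stable y y∈Y)
Stable-∪ Y-stable Z-stable y (inj₂ y∈Z) = inj₂ (Z-stable y y∈Z)

Stable-∩ : Stable Y s → Stable Z s → Stable (Y ∩ Z) s
Stable-∩ Y-stable Z-stable y (y∈Y , y∈Z) = Y-stable y y∈Y , Z-stable y y∈Z

LinSub⇒Stable : LinSub Y → Y s → Stable Y s
LinSub⇒Stable linY s∈Y y y∈Y = proj₁ (proj₂ linY) y _ y∈Y s∈Y

Diff-neg : Diff U s → Diff U (-V s)
Diff-neg (a , b , a∈U , b∈U , refl) = b , a , b∈U , a∈U , +V.⁻¹-anti-homo‿- a b

Half⇒Stable : ∀ {H} → Half H U W → Diff U s → Stable W s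
Half⇒Stable (_ , (W+[U]⊆W , _) , _) s∈[U] y y∈W = W+[U]⊆W _ (y , _ , y∈W , s∈[U] , refl)

module Lemma2p1
  {A H U W X : Subset n} {p q x₀ : V n} {L M : Subset n}
  (linL : LinSub L) (U≐p+L : IsCoset U p L) (linM : LinSub M) (H≐q+M : IsCoset H q M)
  (0∉H : ¬ H 0V) (U⊆H : U ⊆ H) (half : Half H U W) (X-primitive : Primitive (Span U) X)
  (A≐W∪X : A ≐ (W ∪ X)) (X∩[U]≡∅ : ∀ x → X x → ¬ Diff U x) (x₀∈X : X x₀) (x₀∈−U : Neg U x₀)
  where

  module UF = Coset linL U≐p+L
  module HF = Coset linM H≐q+M

  W⊆H : W ⊆ H
  W⊆H = proj₁ half

  U∩W≡∅ : ∀ x → ¬ (U x × W x)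
  U∩W≡∅ = proj₁ (proj₂ (proj₂ (proj₂ half)))

  x₀∈A : A x₀
  x₀∈A = proj₂ A≐W∪X x₀ (inj₂ x₀∈X)

  X⊆C : X ⊆ Graded p L
  X⊆C = Primitive⇒⊆ X-primitive UF.Graded-linear UF.Span⊆Graded

  X-avoids-level₀ : ∀ y → X y → ¬ AtLevel p L f0 y
  X-avoids-level₀ y y∈X y∈₀ = X∩[U]≡∅ y y∈X (UF.level₀⇒Diff y∈₀)

  U-level⇒H-level : AtLevel p L t y → AtLevel q M t y
  U-level⇒H-level = level-transfer linL linM λ x x∈₁ → HF.∈⇒level₁ (U⊆H x (UF.level₁⇒∈ x∈₁))

  H-level-unique : AtLevel q M t y → AtLevel q M u y → t ≡ u
  H-level-unique = HF.level-unique λ 0∈₁ → 0∉H (HF.level₁⇒∈ 0∈₁)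

  C∩W≡∅ : Graded p L y → ¬ W y
  C∩W≡∅ (t , y∈t) y∈W = U∩W≡∅ _ (UF.level₁⇒∈ (UF.level-cast t≡f1 y∈t) , y∈W)
    where t≡f1 = H-level-unique (U-level⇒H-level y∈t) (HF.∈⇒level₁ (W⊆H _ y∈W))

  X≐A∩C : X ≐ (A ∩ Graded p L)
  X≐A∩C = (λ x x∈X → proj₂ A≐W∪X x (inj₂ x∈X) , X⊆C x x∈X) , A∩C⊆X
    where
    A∩C⊆X : (A ∩ Graded p L) ⊆ X
    A∩C⊆X x (x∈A , x∈C) with proj₁ A≐W∪X x x∈A
    ... | inj₁ x∈W = ⊥-elim (C∩W≡∅ x∈C x∈W)
    ... | inj₂ x∈X = x∈X

  A⊆H-graded : ∀ y → A y → Graded q M y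
  A⊆H-graded y y∈A with proj₁ A≐W∪X y y∈A
  ... | inj₁ y∈W = f1 , HF.∈⇒level₁ (W⊆H y y∈W)
  ... | inj₂ y∈X = let t , y∈t = X⊆C y y∈X in t , U-level⇒H-level y∈t

  A-avoids-H-level₀ : ∀ y → A y → ¬ AtLevel q M f0 y
  A-avoids-H-level₀ y y∈A y∈₀ with proj₁ A≐W∪X y y∈A
  ... | inj₁ y∈W with H-level-unique (HF.∈⇒level₁ (W⊆H y y∈W)) y∈₀
  ...   | ()
  A-avoids-H-level₀ y y∈A y∈₀ | inj₂ y∈X =
    let t , y∈t = X⊆C y y∈X
    in X-avoids-level₀ y y∈X (UF.level-cast (H-level-unique (U-level⇒H-level y∈t) y∈₀) y∈t)

  Sym-X⊆Diff-U : Sym X ⊆ Diff U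
  Sym-X⊆Diff-U s s∈SymX =
    UF.level₀⇒Diff (UF.period-at-level₀ X⊆C X-avoids-level₀ (Sym⇒Stable s∈SymX) x₀∈X)

  Sym-X⊆Sym-A : Sym X ⊆ Sym A
  Sym-X⊆Sym-A s s∈SymX =
    Stable⇒Sym (A-stable (Sym⇒Stable s∈SymX) s∈[U]) (A-stable (Sym⇒Stable⁻ s∈SymX) (Diff-neg s∈[U]))
    where
    s∈[U] = Sym-X⊆Diff-U s s∈SymX
    A-stable : ∀ {r} → Stable X r → Diff U r → Stable A r
    A-stable X-stable r∈[U] =
      Stable-resp-≐ A≐W∪X (Stable-∪ (Half⇒Stable half r∈[U]) X-stable)

  -- x₀ ∈ −U lies at level 2 over H, so x₀ + s does too and cannot lie in W ⊆ H.
  Sym-A⊆C : Sym A ⊆ Graded p L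
  Sym-A⊆C s s∈SymA = UF.Graded-translation (X⊆C x₀ x₀∈X) (X⊆C _ x₁∈X)
    where
    A-stable = Sym⇒Stable s∈SymA
    s∈₀ : AtLevel q M f0 s
    s∈₀ = HF.period-at-level₀ A⊆H-graded A-avoids-H-level₀ A-stable x₀∈A
    x₁∈₂ : AtLevel q M f2 (x₀ +V s)
    x₁∈₂ = HF.level-+ (U-level⇒H-level (UF.Neg⇒level₂ x₀∈−U)) s∈₀
    x₁∈X : X (x₀ +V s)
    x₁∈X with proj₁ A≐W∪X _ (A-stable x₀ x₀∈A)
    ... | inj₂ x₁∈X = x₁∈X
    ... | inj₁ x₁∈W with H-level-unique (HF.∈⇒level₁ (W⊆H _ x₁∈W)) x₁∈₂
    ...   | ()

  Sym-A⊆Sym-X : Sym A ⊆ Sym X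
  Sym-A⊆Sym-X s s∈SymA =
    Stable⇒Sym (X-stable (Sym⇒Stable s∈SymA) s∈C) (X-stable (Sym⇒Stable⁻ s∈SymA) -s∈C)
    where
    s∈C = Sym-A⊆C s s∈SymA
    -s∈C = proj₂ (proj₂ UF.Graded-linear) f2 s s∈C
    X-stable : ∀ {r} → Stable A r → Graded p L r → Stable X r
    X-stable A-stable r∈C =
      Stable-resp-≐ X≐A∩C (Stable-∩ A-stable (LinSub⇒Stable UF.Graded-linear r∈C))

lemma2p1 : ∀ {n : ℕ} (A H U W X : Subset n)
    → Hyperplane (Full n) H → ¬ H 0V
    → ProperAffSub U H
    → Half H U W
    → Primitive (Span U) X
    → A ≐ (W ∪ X)
    → (∀ x → X x → ¬ Diff U x)
    → CondIII H U X
    → AffHull (X ∩ Neg U) ≐ Neg U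
    → (Sym A ≐ Sym X) × (Sym X ⊆ Diff U)
lemma2p1 A H U W X ((q , M , linM , H≐q+M) , _) 0∉H ((p , L , linL , U≐p+L) , U⊆H , _)
         half X-primitive A≐W∪X X∩[U]≡∅ _ (_ , −U⊆aff)
  with AffHull-inhabited (−U⊆aff (-V p) (p , Coset.base∈ linL U≐p+L , refl))
... | x₀ , x₀∈X , x₀∈−U = (Sym-A⊆Sym-X , Sym-X⊆Sym-A) , Sym-X⊆Diff-U
  where
  open Lemma2p1 linL U≐p+L linM H≐q+M 0∉H U⊆H half X-primitive A≐W∪X X∩[U]≡∅ x₀∈X x₀∈−U
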